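{- For every integer $i\ge 7$, taking the Fibonacci word $F_i$ as the text, the net frequency of $F_{i-2}$ in $F_i$ satisfies $\phi(F_{i-2})\ge 1$.
   Context: Fibonacci words: $F_1=\texttt{b}$, $F_2=\texttt{a}$, $F_i=F_{i-1}F_{i-2}$ for $i\ge 3$. For a text $T$ of length $n$ and $1\le s\le e\le n$, let $f(W)$ be the number of occurrences of $W$ in $T$. An occurrence $(s,e)$ is a net occurrence if $f(T[s\ldots e])\ge 2$, $f(T[s-1\ldots e])=1$ and $f(T[s\ldots e+1])=1$, where the second condition is considered true when $s=1$ and the third when $e=n$. The net frequency $\phi(S)$ of $S$ in $T$ is the number of net occurrences $(s,e)$ with $T[s\ldots e]=S$. -}

module Defs where

open import Data.Nat using (ℕ; zero; suc; _+_; _∸_; _≡ᵇ_; _≤ᵇ_)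
open import Data.Bool using (Bool; true; false; _∧_; _∨_; if_then_else_)
open import Data.List using (List; []; _∷_; _++_; length; take; drop; filter; map; concatMap; upTo)
open import Data.Product using (_×_; _,_)
import Data.List.Base as L

data Letter : Set where
  a b : Letter

_==ᴸ_ : Letter → Letter → Bool
a ==ᴸ a = true
b ==ᴸ b = true
_ ==ᴸ _ = false

Word : Set
Word = List Letter

-- Fibonacci words: F 1 = b, F 2 = a, F i = F (i-1) F (i-2) for i ≥ 3
-- (F 0 is an unused dummy value.)
F : ℕ → Word
F 0 = []
F 1 = b ∷ []
F 2 = a ∷ []
F (suc (suc (suc i))) = F (suc (suc i)) ++ F (suc i)

isPrefix : Word → Word → Bool
isPrefix [] _ = true
isPrefix (_ ∷ _) [] = false
isPrefix (x ∷ xs) (y ∷ ys) = (x ==ᴸ y) ∧ isPrefix xs ys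

_==ᵂ_ : Word → Word → Bool
[] ==ᵂ [] = true
(x ∷ xs) ==ᵂ (y ∷ ys) = (x ==ᴸ y) ∧ (xs ==ᵂ ys)
_ ==ᵂ _ = false

occ : Word → Word → ℕ
occ T W = length (filter (λ p → isPrefix W (drop p T) Data.Bool.≟ true) (upTo (length T)))

-- T[s … e] (1-based, inclusive), for 1 ≤ s ≤ e ≤ n
sub : Word → ℕ → ℕ → Word
sub T s e = take (suc e ∸ s) (drop (s ∸ 1) T)

-- (s , e) is a net occurrence in T (assuming 1 ≤ s ≤ e ≤ n)
isNet : Word → ℕ → ℕ → Bool
isNet T s e =
  (2 ≤ᵇ occ T (sub T s e))
  ∧ ((s ≡ᵇ 1) ∨ (occ T (sub T (s ∸ 1) e) ≡ᵇ 1))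
  ∧ ((e ≡ᵇ length T) ∨ (occ T (sub T s (suc e)) ≡ᵇ 1))

pairs : ℕ → List (ℕ × ℕ)
pairs n = concatMap (λ s → map (λ e → (s , e)) (L.applyUpTo (λ k → k + s) (suc n ∸ s)))
                    (L.applyUpTo suc n)

netFreq : Word → Word → ℕ
netFreq T S = length (filter (λ { (s , e) → ((sub T s e ==ᵂ S) ∧ isNet T s e) Data.Bool.≟ true })
                             (pairs (length T)))

-- Write σ for the Fibonacci morphism a ↦ ab, b ↦ a, so that F (k + 2) = σ (F (k + 1)).
-- Let ℓ be the last letter of F k and x ≠ ℓ the last letter of F (k + 1). Desubstituting
-- along σ shows, by induction on k, that x · F k occurs in F (k + 2) = F (k + 1) F k only
-- as a suffix. Now take T = F i = F (i - 1) F (i - 2) with i ≥ 4: the suffix F (i - 2) of T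
-- also occurs at position 0 (it is a prefix of F (i - 1)), so it occurs at least twice,
-- while its left extension x · F (i - 2) occurs once and its right extension does not exist.
-- Hence the suffix occurrence of F (i - 2) is a net occurrence.
module Submission where

open import Defs
open import Data.Bool using (true; _∧_)
open import Data.Bool.Properties using (T-≡)
open import Data.List using (List; []; _∷_; _++_; length; filter; upTo; drop; take; applyUpTo)
open import Data.List.Membership.Propositional using (_∈_; lose)
open import Data.List.Membership.Propositional.Properties
  using (∈-length; ∈-filter⁺; ∈-filter⁻; ∈-upTo⁺; ∈-upTo⁻; ∈-applyUpTo⁺; ∈-map⁺; ∈-concatMap⁺; ∈-++⁺ʳ)
open import Data.List.Properties
  using (++-assoc; ++-identityʳ; ++-cancelʳ; ∷-injectiveʳ; length-++; length-++-≤ˡ; length-take; take-all; take++drop≡id)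
open import Data.List.Relation.Unary.All using (_∷_)
open import Data.List.Relation.Unary.AllPairs using (_∷_)
open import Data.List.Relation.Unary.Any using (here; there)
open import Data.List.Relation.Unary.Unique.Propositional using (Unique)
import Data.List.Relation.Unary.Unique.Propositional.Properties as Unique
open import Data.Nat using (ℕ; zero; suc; _+_; _∸_; _≤_; _<_; s≤s; z≤n)
open import Data.Nat.Properties
  using (≤-refl; ≤-trans; ≤-reflexive; <⇒≤; <-trans; <⇒≢; +-comm; +-monoʳ-≤; m<m+n;
         m≤n⇒m⊓n≡m; m∸n+n≡m; ∸-monoˡ-<; m≤m+n; m≤n⇒∃[o]m+o≡n; ≤⇒≤ᵇ; ≡⇒≡ᵇ; module ≤-Reasoning)
open import Data.Product using (_×_; _,_; ∃; ∃₂)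
open import Data.Empty using (⊥-elim)
open import Function using (_∘_; Equivalence)
open import Level using (Level)
open import Relation.Binary.PropositionalEquality
open import Relation.Nullary using (contradiction)
open import Relation.Unary using (Pred; Decidable)

private
  variable
    A : Set
    x y : A
    xs : List A

σ : Word → Word
σ []      = []
σ (a ∷ w) = a ∷ b ∷ σ w
σ (b ∷ w) = a ∷ σ w

σ-++ : ∀ u v → σ (u ++ v) ≡ σ u ++ σ v
σ-++ []      v = refl
σ-++ (a ∷ u) v = cong (λ w → a ∷ b ∷ w) (σ-++ u v)
σ-++ (b ∷ u) v = cong (a ∷_) (σ-++ u v)

σ-≢b∷ : ∀ T r → σ T ≢ b ∷ r
σ-≢b∷ []      r ()
σ-≢b∷ (a ∷ T) r ()
σ-≢b∷ (b ∷ T) r ()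

F-σ : ∀ k → F (2 + k) ≡ σ (F (suc k))
F-σ zero          = refl
F-σ (suc zero)    = refl
F-σ (suc (suc k)) = trans (cong₂ _++_ (F-σ (suc k)) (F-σ k)) (sym (σ-++ (F (2 + k)) (F (suc k))))

F-σ-++ : ∀ k u w → F (suc k) ≡ u ++ w → F (2 + k) ≡ σ u ++ σ w
F-σ-++ k u w eq = trans (F-σ k) (trans (cong σ eq) (σ-++ u w))

σ-suffix-at-a : ∀ T u r → σ T ≡ u ++ a ∷ r → ∃₂ λ T₁ T₂ → T ≡ T₁ ++ T₂ × σ T₂ ≡ a ∷ r
σ-suffix-at-a T       []          r e = [] , T , refl , e
σ-suffix-at-a (a ∷ T) (_ ∷ _ ∷ u) r e with σ-suffix-at-a T u r (cong (drop 2) e)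
... | T₁ , T₂ , refl , σT₂ = a ∷ T₁ , T₂ , refl , σT₂
σ-suffix-at-a (b ∷ T) (_ ∷ u)     r e with σ-suffix-at-a T u r (cong (drop 1) e)
... | T₁ , T₂ , refl , σT₂ = b ∷ T₁ , T₂ , refl , σT₂
σ-suffix-at-a []      (_ ∷ _)     r ()
σ-suffix-at-a (a ∷ T) (_ ∷ [])    r ()

σ-suffix-at-b : ∀ T u r → σ T ≡ u ++ b ∷ r → ∃₂ λ T₁ T₂ → T ≡ T₁ ++ a ∷ T₂ × σ T₂ ≡ r
σ-suffix-at-b T       []          r e    = ⊥-elim (σ-≢b∷ T r e)
σ-suffix-at-b (a ∷ T) (_ ∷ [])    r refl = [] , T , refl , refl
σ-suffix-at-b (a ∷ T) (_ ∷ _ ∷ u) r e with σ-suffix-at-b T u r (cong (drop 2) e)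
... | T₁ , T₂ , refl , σT₂ = a ∷ T₁ , T₂ , refl , σT₂
σ-suffix-at-b (b ∷ T) (_ ∷ u)     r e with σ-suffix-at-b T u r (cong (drop 1) e)
... | T₁ , T₂ , refl , σT₂ = b ∷ T₁ , T₂ , refl , σT₂
σ-suffix-at-b []      (_ ∷ _)     r ()

σ-bb-free : ∀ T u v → σ T ≢ u ++ b ∷ b ∷ v
σ-bb-free T u v e with σ-suffix-at-b T u (b ∷ v) e
... | _ , T₂ , _ , σT₂ = σ-≢b∷ T₂ v σT₂

F-bb-free : ∀ k u v → F (suc k) ≢ u ++ b ∷ b ∷ v
F-bb-free zero    []          v ()
F-bb-free zero    (_ ∷ [])    v ()
F-bb-free zero    (_ ∷ _ ∷ _) v ()
F-bb-free (suc k) u           v = σ-bb-free (F (suc k)) u v ∘ trans (sym (F-σ k))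

-- The hypothesis is needed: σ (W₀ ++ b ∷ []) ++ b ∷ v ≡ σ (W₀ ++ a ∷ []) ++ v.
σ-cancelˡ : ∀ W T v → (∀ W₀ → W ≢ W₀ ++ b ∷ []) → σ T ≡ σ W ++ v →
            ∃ λ v′ → T ≡ W ++ v′ × σ v′ ≡ v
σ-cancelˡ []          T       v _  e = T , refl , e
σ-cancelˡ (a ∷ W)     (a ∷ T) v W≢ e
  with σ-cancelˡ W T v (λ W₀ → W≢ (a ∷ W₀) ∘ cong (a ∷_)) (cong (drop 2) e)
... | v′ , refl , σv′ = v′ , refl , σv′
σ-cancelˡ (b ∷ W)     (b ∷ T) v W≢ e
  with σ-cancelˡ W T v (λ W₀ → W≢ (b ∷ W₀) ∘ cong (b ∷_)) (cong (drop 1) e)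
... | v′ , refl , σv′ = v′ , refl , σv′
σ-cancelˡ (a ∷ W)     (b ∷ T) v _  e = ⊥-elim (σ-≢b∷ T _ (cong (drop 1) e))
σ-cancelˡ (b ∷ [])    (a ∷ T) v W≢ _ = ⊥-elim (W≢ [] refl)
σ-cancelˡ (b ∷ a ∷ W) (a ∷ T) v _  ()
σ-cancelˡ (b ∷ b ∷ W) (a ∷ T) v _  ()
σ-cancelˡ (a ∷ W)     []      v _  ()
σ-cancelˡ (b ∷ W)     []      v _  ()

σ-cancelˡ-a : ∀ W T v → σ T ≡ σ W ++ a ∷ v → ∃ λ v′ → T ≡ W ++ v′ × σ v′ ≡ a ∷ v
σ-cancelˡ-a []          T       v e = T , refl , e
σ-cancelˡ-a (a ∷ W)     (a ∷ T) v e with σ-cancelˡ-a W T v (cong (drop 2) e)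
... | v′ , refl , σv′ = v′ , refl , σv′
σ-cancelˡ-a (b ∷ W)     (b ∷ T) v e with σ-cancelˡ-a W T v (cong (drop 1) e)
... | v′ , refl , σv′ = v′ , refl , σv′
σ-cancelˡ-a (a ∷ W)     (b ∷ T) v e = ⊥-elim (σ-≢b∷ T _ (cong (drop 1) e))
σ-cancelˡ-a (b ∷ [])    (a ∷ T) v ()
σ-cancelˡ-a (b ∷ a ∷ W) (a ∷ T) v ()
σ-cancelˡ-a (b ∷ b ∷ W) (a ∷ T) v ()
σ-cancelˡ-a (a ∷ W)     []      v ()
σ-cancelˡ-a (b ∷ W)     []      v ()

OccursOnlyBeforeLast : Letter → Word → Word → Set
OccursOnlyBeforeLast ℓ w T = ∀ u v → T ≡ u ++ w ++ v → v ≡ ℓ ∷ []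

OccursOnlyAsSuffix : Word → Word → Set
OccursOnlyAsSuffix w T = ∀ u v → T ≡ u ++ w ++ v → v ≡ []

onlyBeforeLast⇒onlyAsSuffix : ∀ {ℓ w T} → OccursOnlyBeforeLast ℓ w T → OccursOnlyAsSuffix (w ++ ℓ ∷ []) T
onlyBeforeLast⇒onlyAsSuffix {ℓ} {w} only u v e =
  ∷-injectiveʳ (only u (ℓ ∷ v) (trans e (cong (u ++_) (++-assoc w (ℓ ∷ []) v))))

σ-onlyBeforeLast-a : ∀ G T → OccursOnlyBeforeLast a (b ∷ G) T →
                     OccursOnlyBeforeLast b (a ∷ σ G ++ a ∷ []) (σ T)
σ-onlyBeforeLast-a G T only u v e
  with T₁ , T₂ , refl , σT₂ ← σ-suffix-at-a T u _ e
  with v′ , refl , σv′ ← σ-cancelˡ-a (b ∷ G) T₂ v (trans σT₂ (cong (a ∷_) (++-assoc (σ G) (a ∷ []) v)))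
  with refl ← only T₁ v′ refl
  = sym (∷-injectiveʳ σv′)

σ-onlyBeforeLast-b : ∀ G T → (∀ W → G ≢ W ++ b ∷ []) → OccursOnlyBeforeLast b (a ∷ G) T →
                     OccursOnlyBeforeLast a (b ∷ σ G) (σ T)
σ-onlyBeforeLast-b G T G≢ only u v e
  with T₁ , T₂ , refl , σT₂ ← σ-suffix-at-b T u _ e
  with v′ , refl , σv′ ← σ-cancelˡ G T₂ v G≢ σT₂
  with refl ← only T₁ v′ refl
  = sym σv′

other : Letter → Letter
other a = b
other b = a

-- The junction of F (k + 2) = F (k + 1) F k is the last letter of F (k + 1) followed by F k.
-- Its uniqueness is stated for F k without its last letter ℓ, the form that survives
-- desubstitution along σ.
record UniqueJunction (k : ℕ) : Set where
  constructor junction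
  field
    ℓ : Letter
    G H : Word
    F-k : F k ≡ G ++ ℓ ∷ []
    F-suc-k : F (suc k) ≡ H ++ other ℓ ∷ []
    onlyBeforeLast : OccursOnlyBeforeLast ℓ (other ℓ ∷ G) (F (2 + k))

uniqueJunction-1 : UniqueJunction 1
uniqueJunction-1 = junction b [] [] refl refl only
  where
  only : OccursOnlyBeforeLast b (a ∷ []) (a ∷ b ∷ [])
  only []              _ refl = refl
  only (_ ∷ [])        _ ()
  only (_ ∷ _ ∷ [])    _ ()
  only (_ ∷ _ ∷ _ ∷ _) _ ()

uniqueJunction-step : ∀ {k} → UniqueJunction (suc k) → UniqueJunction (2 + k)
uniqueJunction-step {k} (junction a G H F-k F-suc-k only) =
  junction b (σ G ++ a ∷ []) (σ H)
    (trans (F-σ-++ k G (a ∷ []) F-k) (sym (++-assoc (σ G) (a ∷ []) (b ∷ []))))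
    (F-σ-++ (suc k) H (b ∷ []) F-suc-k)
    (subst (OccursOnlyBeforeLast b _) (sym (F-σ (2 + k))) (σ-onlyBeforeLast-a G _ only))
uniqueJunction-step {k} (junction b G H F-k F-suc-k only) =
  junction a (σ G) (σ H ++ a ∷ [])
    (F-σ-++ k G (b ∷ []) F-k)
    (trans (F-σ-++ (suc k) H (a ∷ []) F-suc-k) (sym (++-assoc (σ H) (a ∷ []) (b ∷ []))))
    (subst (OccursOnlyBeforeLast a _) (sym (F-σ (2 + k))) (σ-onlyBeforeLast-b G _ G≢ only))
  where
  G≢ : ∀ W → G ≢ W ++ b ∷ []
  G≢ W refl = F-bb-free k W [] (trans F-k (++-assoc W (b ∷ []) (b ∷ [])))

uniqueJunction : ∀ k → UniqueJunction (suc k)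
uniqueJunction zero    = uniqueJunction-1
uniqueJunction (suc k) = uniqueJunction-step (uniqueJunction k)

2≤length : x ∈ xs → y ∈ xs → x ≢ y → 2 ≤ length xs
2≤length {xs = _ ∷ _ ∷ _} _           _           _   = s≤s (s≤s z≤n)
2≤length                  (here refl) (here refl) x≢y = contradiction refl x≢y

length≡1 : Unique xs → x ∈ xs → (∀ {y} → y ∈ xs → y ≡ x) → length xs ≡ 1
length≡1 {xs = _ ∷ []}    _               _ _     = refl
length≡1 {xs = _ ∷ _ ∷ _} ((y≢z ∷ _) ∷ _) _ all≡x =
  contradiction (trans (all≡x (here refl)) (sym (all≡x (there (here refl))))) y≢z

module _ {p : Level} {P : Pred ℕ p} (P? : Decidable P) where

  2≤count : ∀ {i j n} → i < j → j < n → P i → P j → 2 ≤ length (filter P? (upTo n))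
  2≤count i<j j<n Pi Pj =
    2≤length (∈-filter⁺ P? (∈-upTo⁺ (<-trans i<j j<n)) Pi) (∈-filter⁺ P? (∈-upTo⁺ j<n) Pj) (<⇒≢ i<j)

  count≡1 : ∀ {i n} → i < n → P i → (∀ {j} → j < n → P j → j ≡ i) → length (filter P? (upTo n)) ≡ 1
  count≡1 {i} {n} i<n Pi unique =
    length≡1 (Unique.filter⁺ P? (Unique.upTo⁺ n)) (∈-filter⁺ P? (∈-upTo⁺ i<n) Pi) only-i
    where
    only-i : ∀ {j} → j ∈ filter P? (upTo n) → j ≡ i
    only-i j∈ with j∈upTo , Pj ← ∈-filter⁻ P? j∈ = unique (∈-upTo⁻ j∈upTo) Pj

isPrefix-++ : ∀ W v → isPrefix W (W ++ v) ≡ true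
isPrefix-++ []      v = refl
isPrefix-++ (a ∷ W) v = isPrefix-++ W v
isPrefix-++ (b ∷ W) v = isPrefix-++ W v

isPrefix⇒++ : ∀ W X → isPrefix W X ≡ true → ∃ λ v → X ≡ W ++ v
isPrefix⇒++ []      X       _ = X , refl
isPrefix⇒++ (a ∷ W) (a ∷ X) e with v , refl ← isPrefix⇒++ W X e = v , refl
isPrefix⇒++ (b ∷ W) (b ∷ X) e with v , refl ← isPrefix⇒++ W X e = v , refl
isPrefix⇒++ (a ∷ W) (b ∷ X) ()
isPrefix⇒++ (b ∷ W) (a ∷ X) ()
isPrefix⇒++ (_ ∷ W) []      ()

==ᵂ-refl : ∀ W → (W ==ᵂ W) ≡ true
==ᵂ-refl []      = refl
==ᵂ-refl (a ∷ W) = ==ᵂ-refl W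
==ᵂ-refl (b ∷ W) = ==ᵂ-refl W

occursAt : ∀ u W {v T} → T ≡ u ++ W ++ v → isPrefix W (drop (length u) T) ≡ true
occursAt []      W {v} refl = isPrefix-++ W v
occursAt (_ ∷ u) W     refl = occursAt u W refl

occursAt⇒++ : ∀ {W} p T → p ≤ length T → isPrefix W (drop p T) ≡ true →
              ∃₂ λ u v → T ≡ u ++ W ++ v × length u ≡ p
occursAt⇒++ {W} p T p≤n occ with v , drop≡ ← isPrefix⇒++ W (drop p T) occ =
  take p T , v , trans (sym (take++drop≡id p T)) (cong (take p T ++_) drop≡) ,
  trans (length-take p T) (m≤n⇒m⊓n≡m p≤n)

2≤occ-border : ∀ B C → 0 < length B → 2 ≤ occ ((B ++ C) ++ B) B
2≤occ-border B C 0<|B| =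
  2≤count _ 0<|BC| |BC|<n (occursAt [] B (++-assoc B C B))
                          (occursAt (B ++ C) B (cong ((B ++ C) ++_) (sym (++-identityʳ B))))
  where
  0<|BC| : 0 < length (B ++ C)
  0<|BC| = ≤-trans 0<|B| (length-++-≤ˡ B)
  |BC|<n : length (B ++ C) < length ((B ++ C) ++ B)
  |BC|<n = ≤-trans (m<m+n (length (B ++ C)) 0<|B|) (≤-reflexive (sym (length-++ (B ++ C))))

occ≡1-suffix : ∀ {T} H W → T ≡ H ++ W → 0 < length W → OccursOnlyAsSuffix W T → occ T W ≡ 1
occ≡1-suffix {T} H W T≡ 0<|W| onlySuffix =
  count≡1 _ |H|<n (occursAt H W (trans T≡ (cong (H ++_) (sym (++-identityʳ W))))) only-|H|
  where
  |H|<n : length H < length T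
  |H|<n = ≤-trans (m<m+n (length H) 0<|W|)
                  (≤-reflexive (sym (trans (cong length T≡) (length-++ H))))
  only-|H| : ∀ {j} → j < length T → isPrefix W (drop j T) ≡ true → j ≡ length H
  only-|H| {j} j<n occ with u , v , T≡u++W++v , refl ← occursAt⇒++ j T (<⇒≤ j<n) occ
                       with refl ← onlySuffix u v T≡u++W++v =
    cong length (++-cancelʳ W u H
      (trans (cong (u ++_) (sym (++-identityʳ W))) (trans (sym T≡u++W++v) T≡)))

sub-suffix : ∀ P S → sub (P ++ S) (suc (length P)) (length (P ++ S)) ≡ S
sub-suffix []      S = take-all (length S) S ≤-refl
sub-suffix (_ ∷ P) S = sub-suffix P S

sub-suffix-∷ : ∀ P x S → sub (P ++ x ∷ S) (2 + length P) (length (P ++ x ∷ S)) ≡ S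
sub-suffix-∷ []      _ S = sub-suffix [] S
sub-suffix-∷ (_ ∷ P) x S = sub-suffix-∷ P x S

∈-pairs : ∀ {s e n} → 1 ≤ s → s ≤ e → e ≤ n → (s , e) ∈ pairs n
∈-pairs {suc s} {e} {n} _ s≤e e≤n =
  ∈-concatMap⁺ _ (lose (∈-applyUpTo⁺ suc (≤-trans s≤e e≤n)) (∈-map⁺ (suc s ,_) e∈))
  where
  e∈ : e ∈ applyUpTo (_+ suc s) (suc n ∸ suc s)
  e∈ = subst (_∈ _) (m∸n+n≡m s≤e) (∈-applyUpTo⁺ (_+ suc s) (∸-monoˡ-< (s≤s e≤n) s≤e))

netFreq-suffix : ∀ {T} H x S → T ≡ H ++ x ∷ S → 0 < length S →
                 2 ≤ occ T S → occ T (x ∷ S) ≡ 1 → 1 ≤ netFreq T S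
netFreq-suffix H x S refl 0<|S| 2≤occ occ≡1 =
  ∈-length (∈-filter⁺ _ (∈-pairs (s≤s z≤n) s≤n ≤-refl) netOccurrence)
  where
  T = H ++ x ∷ S
  n = length T
  s≤n : 2 + length H ≤ n
  s≤n = begin
    2 + length H              ≡⟨ +-comm 2 (length H) ⟩
    length H + 2              ≤⟨ +-monoʳ-≤ (length H) (s≤s 0<|S|) ⟩
    length H + length (x ∷ S) ≡⟨ length-++ H ⟨
    n                         ∎
    where open ≤-Reasoning
  -- At (s , e) = (2 + |H| , |T|) the test s ≡ᵇ 1 fails, so the left condition is the
  -- uniqueness of x ∷ S, and the right condition holds because e = |T|.
  netOccurrence : ((sub T (2 + length H) n ==ᵂ S) ∧ isNet T (2 + length H) n) ≡ true
  netOccurrence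
    rewrite sub-suffix-∷ H x S | sub-suffix H (x ∷ S) | occ≡1 | ==ᵂ-refl S
          | Equivalence.to T-≡ (≤⇒≤ᵇ 2≤occ) | Equivalence.to T-≡ (≡⇒≡ᵇ n n refl) = refl

F-netFreq : ∀ k → 1 ≤ netFreq (F (4 + k)) (F (2 + k))
F-netFreq k =
  netFreq-suffix H (other ℓ) B F≡ 0<|B| (2≤occ-border B (F (suc k)) 0<|B|)
    (occ≡1-suffix H (other ℓ ∷ B) F≡ (s≤s z≤n) onlySuffix)
  where
  open UniqueJunction (uniqueJunction (suc k))
  B = F (2 + k)
  F≡ : F (4 + k) ≡ H ++ other ℓ ∷ B
  F≡ = trans (cong (_++ B) F-suc-k) (++-assoc H (other ℓ ∷ []) B)
  0<|B| : 0 < length B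
  0<|B| = subst (λ w → 0 < length w) (sym F-k) (∈-length (∈-++⁺ʳ G (here refl)))
  onlySuffix : OccursOnlyAsSuffix (other ℓ ∷ B) (F (4 + k))
  onlySuffix = subst (λ w → OccursOnlyAsSuffix (other ℓ ∷ w) (F (4 + k))) (sym F-k)
                     (onlyBeforeLast⇒onlyAsSuffix onlyBeforeLast)

theorem8 : (i : ℕ) → 7 ≤ i → 1 ≤ netFreq (F i) (F (i ∸ 2))
theorem8 i 7≤i with k , refl ← m≤n⇒∃[o]m+o≡n (≤-trans (m≤m+n 4 3) 7≤i) = F-netFreq k
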